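{- Let $M$ be a matroid on a finite ground set $E$, let $\mathbf{w}:E\to\mathbb{N}$ and $\ell:E\to\mathbb{N}$, where $\mathbb{N}=\{1,2,3,\dots\}$. If $M$ is $\mathbf{w}$-colorable from the lists $L(e)=\{1,2,\dots,\ell(e)\}$, $e\in E$, then $M$ is on-line $(\mathbf{w},\ell)$-colorable.
   Context: Colors are elements of $\mathbb{N}=\{1,2,3,\dots\}$. A $\mathbf{w}$-coloring of $M$ is a function $W:E\to\mathcal{P}(\mathbb{N})$ with $|W(e)|=\mathbf{w}(e)$ for every $e$, such that every coloring $c$ with $c(e)\in W(e)$ for all $e$ is proper (i.e. for each color $j$, the set $\{e: j\in W(e)\}$ is independent in $M$). $M$ is $\mathbf{w}$-colorable from lists $L:E\to\mathcal{P}(\mathbb{N})$ if there is a $\mathbf{w}$-coloring $W$ with $W(e)\subseteq L(e)$ for all $e\in E$. The on-line $(\mathbf{w},\ell)$ game: in round $i=1,2,\dots$, Bob chooses a non-empty set $B_i\subseteq E$ of elements whose lists currently contain fewer than $\ell(e)$ colors and inserts color $i$ into the lists of all elements of $B_i$; then Alice chooses an independent set $A_i\subseteq B_i$ and assigns color $i$ to its elements (she may assign to an element $e$ at most $\mathbf{w}(e)$ colors in total). The game ends when every element $e$ has exactly $\ell(e)$ colors in its list. Alice wins if at the end every element $e$ has been assigned $\mathbf{w}(e)$ colors (so that the assigned color sets form a $\mathbf{w}$-coloring from the lists). $M$ is on-line $(\mathbf{w},\ell)$-colorable if Alice has a winning strategy. -}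

module Defs where

open import Data.Nat using (ℕ; zero; suc; _≤_; _<_; _≟_)
open import Data.Bool using (Bool; true; false; T; if_then_else_)
open import Data.Fin using (Fin)
open import Data.Fin.Subset using (Subset; _∈_; _∉_; _⊆_; _∪_; ⁅_⁆; ∣_∣; ⊥; Nonempty)
open import Data.Vec using (lookup; tabulate)
open import Data.List using (List; length)
open import Data.List.Relation.Unary.Any using (any?)
open import Data.List.Relation.Unary.Unique.Propositional using (Unique)
import Data.List.Membership.Propositional as LM
open import Data.Product using (Σ; ∃; _×_; _,_)
open import Relation.Nullary using (does)
open import Relation.Binary.PropositionalEquality using (_≡_)

record Matroid (n : ℕ) : Set where
  field
    indep       : Subset n → Bool
    indep-empty : T (indep ⊥)
    indep-sub   : ∀ X Y → Y ⊆ X → T (indep X) → T (indep Y)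
    indep-aug   : ∀ X Y → T (indep X) → T (indep Y) → ∣ X ∣ < ∣ Y ∣ →
                  ∃ λ e → e ∈ Y × e ∉ X × T (indep (X ∪ ⁅ e ⁆))
open Matroid public

module _ {n : ℕ} (M : Matroid n) where

  colourClass : (Fin n → List ℕ) → ℕ → Subset n
  colourClass W j = tabulate (λ e → does (any? (j ≟_) (W e)))

  IsWColoring : (w : Fin n → ℕ) → (Fin n → List ℕ) → Set
  IsWColoring w W =
    (∀ e → Unique (W e)) × (∀ e → length (W e) ≡ w e) ×
    (∀ j → T (indep M (colourClass W j)))

  WColorableFromInitialLists : (w ℓ : Fin n → ℕ) → Set
  WColorableFromInitialLists w ℓ =
    Σ (Fin n → List ℕ) λ W → IsWColoring w W ×
      (∀ e j → j LM.∈ W e → 1 ≤ j × j ≤ ℓ e)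

  bump : (Fin n → ℕ) → Subset n → Fin n → ℕ
  bump s X e = if lookup X e then suc (s e) else s e

  -- A position records, for each element e, the current
  -- list size s e and the number a e of colours already assigned to e.
  data AliceWins (w ℓ : Fin n → ℕ) (s a : Fin n → ℕ) : Set where
    win : ((∀ e → s e ≡ ℓ e) → ∀ e → a e ≡ w e) →
          (∀ (B : Subset n) → Nonempty B → (∀ e → e ∈ B → s e < ℓ e) →
             Σ (Subset n) λ A → A ⊆ B × T (indep M A) ×
               (∀ e → e ∈ A → a e < w e) ×
               AliceWins w ℓ (bump s B) (bump a A)) →
          AliceWins w ℓ s a

  OnlineColorable : (w ℓ : Fin n → ℕ) → Set
  OnlineColorable w ℓ = AliceWins w ℓ (λ _ → 0) (λ _ → 0)

-- Write W e for the number of colours e still needs and L e for the number of colours still to be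
-- offered to e. By Edmonds' matroid union theorem, M is W-colourable from the lists {1, …, L e}
-- exactly when W(X) ≤ ∑ⱼ r(X ∩ Eⱼ) for every X, where Eⱼ = {e | L e ≥ j} and r is the rank of M;
-- a colouring from the initial lists gives this condition, and Alice maintains it. When Bob offers
-- a colour to B, submodularity of r telescopes over the levels Eⱼ to
-- ∑ⱼ r(X ∩ Eⱼ) ≤ r(X ∩ B) + ∑ⱼ r(X ∩ E′ⱼ), where E′ⱼ are the levels after the move. This is the union
-- condition for M ↾ B together with the new levels, so the union theorem gives a cover: its part in
-- M ↾ B is Alice's independent answer, and its other parts show that the condition still holds.
-- When every list is complete all levels are empty, so the condition forces W = 0.

module Submission where

open import Defs
open import Data.Nat.Properties
open import Algebra.Properties.CommutativeSemigroup +-commutativeSemigroup using (interchange)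
open import Algebra.Properties.CommutativeMonoid.Sum +-0-commutativeMonoid
  using (sum; ∑-distrib-+; ∑-comm; sum-cong-≗; sum-replicate-zero; sum-remove)
open import Data.Bool using (Bool; true; false; T; if_then_else_; _∧_; _∨_; not)
open import Data.Bool.Properties renaming (_≟_ to _≟ᵇ_)
  using ( T-≡; ¬-not; ∧-conicalˡ; ∧-conicalʳ; ∨-zeroʳ; ∨-identityʳ; ∧-zeroʳ; ∧-identityʳ
        ; ∧-distribʳ-∨; ∨-distribʳ-∧)
open import Data.Empty using (⊥-elim)
open import Data.Fin using (Fin; zero; suc; punchIn; toℕ; fromℕ<) renaming (_≟_ to _≟ᶠ_)
open import Data.Fin.Properties using (punchInᵢ≢i; all?; any?; toℕ-fromℕ<)
open import Data.Nat using (ℕ; zero; suc; _+_; _∸_; _≤_; _<_; _≤ᵇ_; _≟_; _≤?_; z≤n; s≤s)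
open import Data.Product using (Σ; ∃; _×_; _,_; proj₁; proj₂)
open import Data.Sum using (_⊎_; inj₁; inj₂)
open import Data.Fin.Subset using (Subset; Nonempty; _∈_; _⊆_; _∪_; ⁅_⁆; ∣_∣)
open import Data.Fin.Subset.Properties using (anySubset?; p⊆p∪q; q⊆p∪q; x∈⁅x⁆)
open import Data.List using (List; []; _∷_; allFin; length)
open import Data.List.Relation.Unary.All.Properties using (All¬⇒¬Any)
open import Data.List.Relation.Unary.AllPairs using (_∷_)
open import Data.List.Relation.Unary.Unique.Propositional using (Unique)
open import Data.List.Membership.Propositional using () renaming (_∈_ to _∈ˡ_)
open import Data.List.Membership.Propositional.Properties using (∈-allFin)
open import Data.List.Relation.Unary.Any using (here; there) renaming (any? to any?ˡ)
open import Data.Vec using (lookup; tabulate)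
open import Data.Vec.Properties using (lookup∘tabulate; []=⇒lookup; lookup⇒[]=)
open import Data.Vec.Functional using (Vector; updateAt) renaming (_∷_ to _◂_)
open import Data.Vec.Functional.Properties using (updateAt-updates; updateAt-minimal)
open import Function using (_∘_; id; Equivalence)
open import Relation.Nullary using (¬_; yes; no; does; Dec; contradiction)
open import Relation.Nullary.Decidable using (_×-dec_; _→-dec_; dec-true; dec-false)
open import Relation.Binary.PropositionalEquality

∑-zero : ∀ {n} {f : Vector ℕ n} → (∀ i → f i ≡ 0) → sum f ≡ 0
∑-zero {n} f≗0 = trans (sum-cong-≗ f≗0) (sum-replicate-zero n)

∑-mono-≤ : ∀ {n} {f g : Vector ℕ n} → (∀ i → f i ≤ g i) → sum f ≤ sum g
∑-mono-≤ {zero}  f≤g = z≤n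
∑-mono-≤ {suc n} f≤g = +-mono-≤ (f≤g zero) (∑-mono-≤ (f≤g ∘ suc))

∑-mono-< : ∀ {n} {f g : Vector ℕ n} → (∀ i → f i ≤ g i) → ∀ j → f j < g j → sum f < sum g
∑-mono-< f≤g zero    fj<gj = +-mono-<-≤ fj<gj (∑-mono-≤ (f≤g ∘ suc))
∑-mono-< f≤g (suc j) fj<gj = +-mono-≤-< (f≤g zero) (∑-mono-< (f≤g ∘ suc) j fj<gj)

∑-mono-≤-equality : ∀ {n} {f g : Vector ℕ n} → (∀ i → f i ≤ g i) → sum g ≤ sum f → ∀ i → f i ≡ g i
∑-mono-≤-equality {f = f} {g} f≤g ∑g≤∑f i with f i ≟ g i
... | yes fi≡gi = fi≡gi
... | no  fi≢gi = ⊥-elim (<⇒≱ (∑-mono-< f≤g i (≤∧≢⇒< (f≤g i) fi≢gi)) ∑g≤∑f)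

∑-positive : ∀ {n} (f : Vector ℕ n) → 1 ≤ sum f → ∃ λ i → 1 ≤ f i
∑-positive {suc n} f 1≤∑ with f zero in eq
... | suc _ = zero , subst (1 ≤_) (sym eq) (s≤s z≤n)
... | zero  with ∑-positive (f ∘ suc) 1≤∑
...   | i , 1≤fi = suc i , 1≤fi

∑-update : ∀ {n} (f g : Vector ℕ n) i → (∀ j → j ≢ i → f j ≡ g j) → sum g + f i ≡ sum f + g i
∑-update {suc n} f g i f≗g = begin
  sum g + f i                                 ≡⟨ cong (_+ f i) (sum-remove {i = i} g) ⟩
  g i + sum (g ∘ punchIn i) + f i             ≡⟨ cong (λ s → g i + s + f i) (sum-cong-≗ rest) ⟩
  g i + sum (f ∘ punchIn i) + f i             ≡⟨ +-comm (g i + _) (f i) ⟩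
  f i + (g i + sum (f ∘ punchIn i))           ≡⟨ cong (f i +_) (+-comm (g i) _) ⟩
  f i + (sum (f ∘ punchIn i) + g i)           ≡⟨ +-assoc (f i) _ (g i) ⟨
  f i + sum (f ∘ punchIn i) + g i             ≡⟨ cong (_+ g i) (sum-remove {i = i} f) ⟨
  sum f + g i                                 ∎
  where
  open ≡-Reasoning
  rest : ∀ j → g (punchIn i j) ≡ f (punchIn i j)
  rest j = sym (f≗g (punchIn i j) (punchInᵢ≢i i j))

∑-single : ∀ {n} (f : Vector ℕ n) i → (∀ j → j ≢ i → f j ≡ 0) → sum f ≡ f i
∑-single {n} f i f≗0 = begin
  sum f                    ≡⟨ +-identityʳ (sum f) ⟨
  sum f + 0                ≡⟨ ∑-update (λ _ → 0) f i (λ j j≢i → sym (f≗0 j j≢i)) ⟩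
  sum {n} (λ _ → 0) + f i  ≡⟨ cong (_+ f i) (sum-replicate-zero n) ⟩
  f i                      ∎
  where open ≡-Reasoning

∑-≥-term : ∀ {n} (f : Vector ℕ n) i → f i ≤ sum f
∑-≥-term {suc n} f i = ≤-trans (m≤m+n (f i) _) (≤-reflexive (sym (sum-remove {i = i} f)))

telescoping : ∀ {f g h : ℕ → ℕ} → (∀ s → f s + h (suc s) ≤ g s + h s) →
              ∀ m → sum (λ (j : Fin m) → f (toℕ j)) + h m ≤ sum (λ (j : Fin m) → g (toℕ j)) + h 0
telescoping                 step zero    = m≤n+m _ 0
telescoping {f} {g} {h} step (suc m) = begin
  f 0 + ∑f′ + h (suc m)    ≡⟨ +-assoc (f 0) ∑f′ _ ⟩
  f 0 + (∑f′ + h (suc m))  ≤⟨ +-monoʳ-≤ (f 0) (telescoping {f ∘ suc} {g ∘ suc} {h ∘ suc} (step ∘ suc) m) ⟩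
  f 0 + (∑g′ + h 1)        ≡⟨ cong (f 0 +_) (+-comm ∑g′ (h 1)) ⟩
  f 0 + (h 1 + ∑g′)        ≡⟨ +-assoc (f 0) (h 1) ∑g′ ⟨
  f 0 + h 1 + ∑g′          ≤⟨ +-monoˡ-≤ ∑g′ (step 0) ⟩
  g 0 + h 0 + ∑g′          ≡⟨ +-assoc (g 0) (h 0) ∑g′ ⟩
  g 0 + (h 0 + ∑g′)        ≡⟨ cong (g 0 +_) (+-comm (h 0) ∑g′) ⟩
  g 0 + (∑g′ + h 0)        ≡⟨ +-assoc (g 0) ∑g′ (h 0) ⟨
  g 0 + ∑g′ + h 0          ∎
  where
  open ≤-Reasoning
  ∑f′ = sum (λ (j : Fin m) → f (suc (toℕ j)))
  ∑g′ = sum (λ (j : Fin m) → g (suc (toℕ j)))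

-- Finite sets as Boolean predicates

Subsetᵇ : ℕ → Set
Subsetᵇ n = Fin n → Bool

χ : Bool → ℕ
χ b = if b then 1 else 0

module _ {n : ℕ} where

  infix  4 _∈ᵇ_ _⊆ᵇ_
  infixr 6 _∩ᵇ_
  infixr 5 _∪ᵇ_

  _∈ᵇ_ : Fin n → Subsetᵇ n → Set
  e ∈ᵇ X = X e ≡ true

  _⊆ᵇ_ : Subsetᵇ n → Subsetᵇ n → Set
  X ⊆ᵇ Y = ∀ e → e ∈ᵇ X → e ∈ᵇ Y

  ∅ᵇ : Subsetᵇ n
  ∅ᵇ _ = false

  _∪ᵇ_ _∩ᵇ_ _∖ᵇ_ : Subsetᵇ n → Subsetᵇ n → Subsetᵇ n
  (X ∪ᵇ Y) e = X e ∨ Y e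
  (X ∩ᵇ Y) e = X e ∧ Y e
  (X ∖ᵇ Y) e = X e ∧ not (Y e)

  ⁅_⁆ᵇ : Fin n → Subsetᵇ n
  ⁅ e ⁆ᵇ x = does (x ≟ᶠ e)

  ⊆ᵇ-refl : ∀ {X} → X ⊆ᵇ X
  ⊆ᵇ-refl _ = id

  ⊆ᵇ-trans : ∀ {X Y Z} → X ⊆ᵇ Y → Y ⊆ᵇ Z → X ⊆ᵇ Z
  ⊆ᵇ-trans X⊆Y Y⊆Z e = Y⊆Z e ∘ X⊆Y e

  ∪ᵇ-⊆ˡ : ∀ X Y → X ⊆ᵇ X ∪ᵇ Y
  ∪ᵇ-⊆ˡ X Y e e∈X = cong (_∨ Y e) e∈X

  ∪ᵇ-⊆ʳ : ∀ X Y → Y ⊆ᵇ X ∪ᵇ Y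
  ∪ᵇ-⊆ʳ X Y e e∈Y = trans (cong (X e ∨_) e∈Y) (∨-zeroʳ (X e))

  ∪ᵇ-least : ∀ {X Y Z} → X ⊆ᵇ Z → Y ⊆ᵇ Z → X ∪ᵇ Y ⊆ᵇ Z
  ∪ᵇ-least {X} X⊆Z Y⊆Z e e∈X∪Y with X e in e∈X
  ... | true  = X⊆Z e e∈X
  ... | false = Y⊆Z e e∈X∪Y

  ⊆ᵇ-∉ : ∀ {X Y e} → X ⊆ᵇ Y → Y e ≡ false → X e ≡ false
  ⊆ᵇ-∉ {X} {e = e} X⊆Y e∉Y with X e in e∈X
  ... | false = refl
  ... | true  = contradiction (trans (sym (X⊆Y e e∈X)) e∉Y) λ ()

  ∖ᵇ-⊆ : ∀ X Y → X ∖ᵇ Y ⊆ᵇ X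
  ∖ᵇ-⊆ X Y e = ∧-conicalˡ (X e) (not (Y e))

  ∖ᵇ-∉ : ∀ {X Y e} → e ∈ᵇ X ∖ᵇ Y → Y e ≡ false
  ∖ᵇ-∉ {X} {Y} {e} e∈X∖Y with Y e
  ... | false = refl
  ... | true  = contradiction (trans (sym (∧-zeroʳ (X e))) e∈X∖Y) λ ()

  ∉-∖ᵇ : ∀ {X Y e} → e ∈ᵇ Y → (X ∖ᵇ Y) e ≡ false
  ∉-∖ᵇ {X} {e = e} e∈Y rewrite e∈Y = ∧-zeroʳ (X e)

  ∩ᵇ-⊆ˡ : ∀ X Y → X ∩ᵇ Y ⊆ᵇ X
  ∩ᵇ-⊆ˡ X Y e = ∧-conicalˡ (X e) (Y e)

  ∩ᵇ-⊆ʳ : ∀ X Y → X ∩ᵇ Y ⊆ᵇ Y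
  ∩ᵇ-⊆ʳ X Y e = ∧-conicalʳ (X e) (Y e)

  ∈-∩ᵇ : ∀ X Y {e} → e ∈ᵇ X → e ∈ᵇ Y → e ∈ᵇ X ∩ᵇ Y
  ∈-∩ᵇ _ _ e∈X e∈Y = cong₂ _∧_ e∈X e∈Y

  ∩ᵇ-greatest : ∀ {X Y Z} → X ⊆ᵇ Y → X ⊆ᵇ Z → X ⊆ᵇ Y ∩ᵇ Z
  ∩ᵇ-greatest {Y = Y} {Z} X⊆Y X⊆Z e e∈X = ∈-∩ᵇ Y Z (X⊆Y e e∈X) (X⊆Z e e∈X)

  ∈-⁅⁆ᵇ : ∀ e → e ∈ᵇ ⁅ e ⁆ᵇ
  ∈-⁅⁆ᵇ e with e ≟ᶠ e
  ... | yes _   = refl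
  ... | no  e≢e = ⊥-elim (e≢e refl)

  ∈-⁅⁆ᵇ⇒≡ : ∀ {e x} → x ∈ᵇ ⁅ e ⁆ᵇ → x ≡ e
  ∈-⁅⁆ᵇ⇒≡ {e} {x} x∈⁅e⁆ with x ≟ᶠ e
  ... | yes x≡e = x≡e

  ∉-⁅⁆ᵇ : ∀ {e x} → x ≢ e → ⁅ e ⁆ᵇ x ≡ false
  ∉-⁅⁆ᵇ {e} {x} x≢e with x ≟ᶠ e
  ... | yes x≡e = ⊥-elim (x≢e x≡e)
  ... | no  _   = refl

  ⁅⁆ᵇ-⊆ : ∀ {e X} → e ∈ᵇ X → ⁅ e ⁆ᵇ ⊆ᵇ X
  ⁅⁆ᵇ-⊆ {X = X} e∈X x x∈⁅e⁆ = subst (_∈ᵇ X) (sym (∈-⁅⁆ᵇ⇒≡ x∈⁅e⁆)) e∈X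

  χ⁅⁆≤ : ∀ {w : Fin n → ℕ} {e} → 1 ≤ w e → ∀ x → χ (⁅ e ⁆ᵇ x) ≤ w x
  χ⁅⁆≤ {e = e} 1≤we x with x ≟ᶠ e
  ... | yes refl = 1≤we
  ... | no  _    = z≤n

  weight : (Fin n → ℕ) → Subsetᵇ n → ℕ
  weight w X = sum (λ e → if X e then w e else 0)

  size : Subsetᵇ n → ℕ
  size = weight (λ _ → 1)

  weight-cong : (w : Fin n → ℕ) {X Y : Subsetᵇ n} → (∀ e → X e ≡ Y e) → weight w X ≡ weight w Y
  weight-cong w X≗Y = sum-cong-≗ (λ e → cong (λ b → if b then w e else 0) (X≗Y e))

  weight-∅ : (w : Fin n → ℕ) {X : Subsetᵇ n} → (∀ e → X e ≡ false) → weight w X ≡ 0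
  weight-∅ w X≗∅ = trans (weight-cong w X≗∅) (sum-replicate-zero n)

  weight-⁅⁆ : (w : Fin n → ℕ) (e : Fin n) → weight w ⁅ e ⁆ᵇ ≡ w e
  weight-⁅⁆ w e = trans (∑-single _ e (λ x x≢e → cong (λ b → if b then w x else 0) (∉-⁅⁆ᵇ x≢e)))
                        (cong (λ b → if b then w e else 0) (∈-⁅⁆ᵇ e))

  term-mono : (w : Fin n → ℕ) {X Y : Subsetᵇ n} → X ⊆ᵇ Y → ∀ e → (if X e then w e else 0) ≤ (if Y e then w e else 0)
  term-mono w {X} X⊆Y e with X e in e∈X
  ... | false = z≤n
  ... | true  rewrite X⊆Y e e∈X = ≤-refl

  weight-mono : (w : Fin n → ℕ) {X Y : Subsetᵇ n} → X ⊆ᵇ Y → weight w X ≤ weight w Y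
  weight-mono w {X} {Y} X⊆Y = ∑-mono-≤ (term-mono w {X} {Y} X⊆Y)

  weight-mono-< : (w : Fin n → ℕ) {X Y : Subsetᵇ n} → X ⊆ᵇ Y → ∀ {e} → e ∈ᵇ Y → X e ≡ false → 1 ≤ w e →
                  weight w X < weight w Y
  weight-mono-< w {X} {Y} X⊆Y {e} e∈Y e∉X 1≤we = ∑-mono-< (term-mono w {X} {Y} X⊆Y) e strict
    where
    strict : (if X e then w e else 0) < (if Y e then w e else 0)
    strict rewrite e∈Y | e∉X = 1≤we

  weight-∪ : (w : Fin n → ℕ) {X Y : Subsetᵇ n} → (∀ e → e ∈ᵇ X → Y e ≡ false) →
             weight w (X ∪ᵇ Y) ≡ weight w X + weight w Y
  weight-∪ w {X} {Y} disjoint = trans (sum-cong-≗ term) (∑-distrib-+ (λ e → if X e then w e else 0) _)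
    where
    term : ∀ e → (if X e ∨ Y e then w e else 0) ≡ (if X e then w e else 0) + (if Y e then w e else 0)
    term e with X e in e∈X
    ... | true  rewrite disjoint e e∈X = sym (+-identityʳ (w e))
    ... | false = refl

  weight-∸ : ∀ {u w} X → (∀ e → u e ≤ w e) → weight (λ e → w e ∸ u e) X + weight u X ≡ weight w X
  weight-∸ {u} {w} X u≤w = trans (sym (∑-distrib-+ (λ e → if X e then w e ∸ u e else 0) _)) (sum-cong-≗ term)
    where
    term : ∀ e → (if X e then w e ∸ u e else 0) + (if X e then u e else 0) ≡ (if X e then w e else 0)
    term e with X e
    ... | true  = m∸n+n≡m (u≤w e)
    ... | false = refl

  weight-χ⁅⁆ : ∀ e X → weight (χ ∘ ⁅ e ⁆ᵇ) X ≡ χ (X e)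
  weight-χ⁅⁆ e X = trans (∑-single _ e off) on
    where
    off : ∀ x → x ≢ e → (if X x then χ (⁅ e ⁆ᵇ x) else 0) ≡ 0
    off x x≢e rewrite ∉-⁅⁆ᵇ x≢e with X x
    ... | true  = refl
    ... | false = refl
    on : (if X e then χ (⁅ e ⁆ᵇ e) else 0) ≡ χ (X e)
    on rewrite ∈-⁅⁆ᵇ e with X e
    ... | true  = refl
    ... | false = refl

  size-∅ : size ∅ᵇ ≡ 0
  size-∅ = sum-replicate-zero n

  size-⊆-≥⇒⊇ : ∀ {X Y} → X ⊆ᵇ Y → size Y ≤ size X → Y ⊆ᵇ X
  size-⊆-≥⇒⊇ {X} X⊆Y size≤ e e∈Y with X e in e∈X
  ... | true  = refl
  ... | false = ⊥-elim (<⇒≱ (weight-mono-< _ X⊆Y e∈Y e∈X (s≤s z≤n)) size≤)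

module _ {n : ℕ} where

  ∈-tabulate⁺ : ∀ {X : Subsetᵇ n} {x} → x ∈ᵇ X → x ∈ tabulate X
  ∈-tabulate⁺ {X} {x} x∈X = lookup⇒[]= x (tabulate X) (trans (lookup∘tabulate X x) x∈X)

  ∈-tabulate⁻ : ∀ {X : Subsetᵇ n} {x} → x ∈ tabulate X → x ∈ᵇ X
  ∈-tabulate⁻ {X} {x} x∈X = trans (sym (lookup∘tabulate X x)) ([]=⇒lookup x∈X)

∣tabulate∣ : ∀ {n} (X : Subsetᵇ n) → ∣ tabulate X ∣ ≡ size X
∣tabulate∣ {zero}  X = refl
∣tabulate∣ {suc n} X with X zero
... | true  = cong suc (∣tabulate∣ (X ∘ suc))
... | false = ∣tabulate∣ (X ∘ suc)

-- Rank functions, restriction and contraction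

record RankFunction (n : ℕ) : Set where
  field
    rk            : Subsetᵇ n → ℕ
    rk-≤-size     : ∀ X → rk X ≤ size X
    rk-mono       : ∀ {X Y} → X ⊆ᵇ Y → rk X ≤ rk Y
    rk-submodular : ∀ X Y → rk (X ∪ᵇ Y) + rk (X ∩ᵇ Y) ≤ rk X + rk Y

open RankFunction public

module _ {n : ℕ} where

  Independent : RankFunction n → Subsetᵇ n → Set
  Independent R X = rk R X ≡ size X

  rk-cong : ∀ R {X Y : Subsetᵇ n} → (∀ e → X e ≡ Y e) → rk R X ≡ rk R Y
  rk-cong R X≗Y = ≤-antisym (rk-mono R (λ e → trans (sym (X≗Y e))))
                            (rk-mono R (λ e → trans (X≗Y e)))

  rk-∅ : (R : RankFunction n) → rk R ∅ᵇ ≡ 0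
  rk-∅ R = n≤0⇒n≡0 (≤-trans (rk-≤-size R ∅ᵇ) (≤-reflexive (size-∅ {n})))

  _↾_ : RankFunction n → Subsetᵇ n → RankFunction n
  R ↾ D = record
    { rk            = λ X → rk R (X ∩ᵇ D)
    ; rk-≤-size     = λ X → ≤-trans (rk-≤-size R (X ∩ᵇ D)) (weight-mono _ (∩ᵇ-⊆ˡ X D))
    ; rk-mono       = λ {X} {Y} X⊆Y → rk-mono R (∩ᵇ-greatest {Y = Y} {D} (⊆ᵇ-trans (∩ᵇ-⊆ˡ X D) X⊆Y) (∩ᵇ-⊆ʳ X D))
    ; rk-submodular = λ X Y → ≤-trans
        (+-mono-≤ (≤-reflexive (rk-cong R (λ e → ∧-distribʳ-∨ (D e) (X e) (Y e))))
                  (≤-reflexive (rk-cong R (λ e → ∧-∧-distribʳ (X e) (Y e) (D e)))))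
        (rk-submodular R (X ∩ᵇ D) (Y ∩ᵇ D))
    }
    where
    ∧-∧-distribʳ : ∀ a b d → (a ∧ b) ∧ d ≡ (a ∧ d) ∧ (b ∧ d)
    ∧-∧-distribʳ a     b     false rewrite ∧-zeroʳ a | ∧-zeroʳ (a ∧ b) = refl
    ∧-∧-distribʳ a     b     true  rewrite ∧-identityʳ a | ∧-identityʳ b | ∧-identityʳ (a ∧ b) = refl

  -- The subtraction never truncates, as rk R Z ≤ rk R (X ∪ Z).
  _/_ : RankFunction n → Subsetᵇ n → RankFunction n
  R / Z = record
    { rk            = λ X → rk R (X ∪ᵇ Z) ∸ rk R Z
    ; rk-≤-size     = λ X → m≤n+o⇒m∸n≤o (rk R (X ∪ᵇ Z)) (rk R Z) (bound X)
    ; rk-mono       = λ {X} {Y} X⊆Y →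
                        ∸-monoˡ-≤ (rk R Z) (rk-mono R (∪ᵇ-least (⊆ᵇ-trans X⊆Y (∪ᵇ-⊆ˡ Y Z)) (∪ᵇ-⊆ʳ Y Z)))
    ; rk-submodular = submodular
    }
    where
    Z≤ : ∀ X → rk R Z ≤ rk R (X ∪ᵇ Z)
    Z≤ X = rk-mono R (∪ᵇ-⊆ʳ X Z)
    bound : ∀ X → rk R (X ∪ᵇ Z) ≤ rk R Z + size X
    bound X = begin
      rk R (X ∪ᵇ Z)                         ≤⟨ m≤m+n _ _ ⟩
      rk R (X ∪ᵇ Z) + rk R (X ∩ᵇ Z)         ≤⟨ rk-submodular R X Z ⟩
      rk R X + rk R Z                       ≤⟨ +-monoˡ-≤ (rk R Z) (rk-≤-size R X) ⟩
      size X + rk R Z                       ≡⟨ +-comm (size X) (rk R Z) ⟩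
      rk R Z + size X                       ∎
      where open ≤-Reasoning
    submodular : ∀ X Y → (rk R ((X ∪ᵇ Y) ∪ᵇ Z) ∸ rk R Z) + (rk R ((X ∩ᵇ Y) ∪ᵇ Z) ∸ rk R Z)
                       ≤ (rk R (X ∪ᵇ Z) ∸ rk R Z) + (rk R (Y ∪ᵇ Z) ∸ rk R Z)
    submodular X Y = ∸-+-mono (Z≤ (X ∪ᵇ Y)) (Z≤ (X ∩ᵇ Y)) (Z≤ X) (Z≤ Y) (≤-trans
      (+-mono-≤ (≤-reflexive (rk-cong R (λ e → ∨-∨-distribʳ (X e) (Y e) (Z e))))
                (≤-reflexive (rk-cong R (λ e → ∨-distribʳ-∧ (Z e) (X e) (Y e)))))
      (rk-submodular R (X ∪ᵇ Z) (Y ∪ᵇ Z)))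
      where
      ∨-∨-distribʳ : ∀ a b c → (a ∨ b) ∨ c ≡ (a ∨ c) ∨ (b ∨ c)
      ∨-∨-distribʳ a b true  rewrite ∨-zeroʳ (a ∨ b) | ∨-zeroʳ a = refl
      ∨-∨-distribʳ a b false rewrite ∨-identityʳ (a ∨ b) | ∨-identityʳ a | ∨-identityʳ b = refl
      ∸-+-mono : ∀ {z a b c d} → z ≤ a → z ≤ b → z ≤ c → z ≤ d → a + b ≤ c + d →
                 (a ∸ z) + (b ∸ z) ≤ (c ∸ z) + (d ∸ z)
      ∸-+-mono {z} {a} {b} {c} {d} z≤a z≤b z≤c z≤d a+b≤c+d =
        +-cancelʳ-≤ (z + z) _ _ (subst₂ _≤_ (sym (restore z≤a z≤b)) (sym (restore z≤c z≤d)) a+b≤c+d)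
        where
        restore : ∀ {x y} → z ≤ x → z ≤ y → (x ∸ z) + (y ∸ z) + (z + z) ≡ x + y
        restore {x} {y} z≤x z≤y = trans (interchange (x ∸ z) (y ∸ z) z z) (cong₂ _+_ (m∸n+n≡m z≤x) (m∸n+n≡m z≤y))

  independent-↾ : ∀ R D Y → Independent (R ↾ D) Y → Y ⊆ᵇ D × Independent R Y
  independent-↾ R D Y rk≡size = ⊆ᵇ-trans Y⊆Y∩D (∩ᵇ-⊆ʳ Y D) , trans (rk-cong R Y≗Y∩D) rk≡size
    where
    Y⊆Y∩D : Y ⊆ᵇ Y ∩ᵇ D
    Y⊆Y∩D = size-⊆-≥⇒⊇ (∩ᵇ-⊆ˡ Y D) (≤-trans (≤-reflexive (sym rk≡size)) (rk-≤-size R (Y ∩ᵇ D)))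
    Y≗Y∩D : ∀ e → Y e ≡ (Y ∩ᵇ D) e
    Y≗Y∩D e with Y e in e∈Y
    ... | true  = sym (∩ᵇ-⊆ʳ Y D e (Y⊆Y∩D e e∈Y))
    ... | false = refl

  independent-↾⁺ : ∀ R {D Y} → Y ⊆ᵇ D → Independent R Y → Independent (R ↾ D) Y
  independent-↾⁺ R {D} {Y} Y⊆D Y-indep = trans (rk-cong R Y∩D≗Y) Y-indep
    where
    Y∩D≗Y : ∀ e → Y e ∧ D e ≡ Y e
    Y∩D≗Y e with Y e in e∈Y
    ... | true  = Y⊆D e e∈Y
    ... | false = refl

  independent-⊆ : ∀ R {I J} → J ⊆ᵇ I → Independent R I → Independent R J
  independent-⊆ R {I} {J} J⊆I I-indep = ≤-antisym (rk-≤-size R J) (+-cancelʳ-≤ (size K) _ _ (begin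
    size J + size K                 ≡⟨ weight-∪ _ {J} {K} (λ e → ∉-∖ᵇ {X = I} {Y = J}) ⟨
    size (J ∪ᵇ K)                   ≡⟨ weight-cong _ J∪K≗I ⟩
    size I                          ≡⟨ I-indep ⟨
    rk R I                          ≡⟨ rk-cong R J∪K≗I ⟨
    rk R (J ∪ᵇ K)                   ≡⟨ +-identityʳ _ ⟨
    rk R (J ∪ᵇ K) + 0               ≡⟨ cong (rk R (J ∪ᵇ K) +_) (trans (rk-cong R J∩K≗∅) (rk-∅ R)) ⟨
    rk R (J ∪ᵇ K) + rk R (J ∩ᵇ K)   ≤⟨ rk-submodular R J K ⟩
    rk R J + rk R K                 ≤⟨ +-monoʳ-≤ (rk R J) (rk-≤-size R K) ⟩
    rk R J + size K                 ∎))
    where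
    open ≤-Reasoning
    K = I ∖ᵇ J
    J∪K≗I : ∀ e → (J ∪ᵇ K) e ≡ I e
    J∪K≗I e with J e in e∈J
    ... | true  = sym (J⊆I e e∈J)
    ... | false = ∧-identityʳ (I e)
    J∩K≗∅ : ∀ e → (J ∩ᵇ K) e ≡ ∅ᵇ e
    J∩K≗∅ e with J e
    ... | true  = ∧-zeroʳ (I e)
    ... | false = refl

  independent-∪-/ : ∀ R {X I J} → I ⊆ᵇ X → Independent R I → size I ≡ rk R X →
                    Independent (R / X) J → (∀ e → e ∈ᵇ J → X e ≡ false) → Independent R (I ∪ᵇ J)
  independent-∪-/ R {X} {I} {J} I⊆X I-indep I-spans J-indep disjoint =
    ≤-antisym (rk-≤-size R (I ∪ᵇ J)) (begin
      size (I ∪ᵇ J)        ≡⟨ weight-∪ _ {I} {J} (λ e e∈I → disjoint′ e e∈I) ⟩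
      size I + size J      ≡⟨ +-comm (size I) (size J) ⟩
      size J + size I      ≡⟨ cong (size J +_) I-spans ⟩
      size J + rk R X      ≤⟨ +-cancelʳ-≤ (rk R X) _ _ key ⟩
      rk R (I ∪ᵇ J)        ∎)
    where
    open ≤-Reasoning
    disjoint′ : ∀ e → e ∈ᵇ I → J e ≡ false
    disjoint′ e e∈I with J e in e∈J
    ... | false = refl
    ... | true  = contradiction (trans (sym (disjoint e e∈J)) (I⊆X e e∈I)) λ ()
    X≤J∪X : rk R X ≤ rk R (J ∪ᵇ X)
    X≤J∪X = rk-mono R (∪ᵇ-⊆ʳ J X)
    key : size J + rk R X + rk R X ≤ rk R (I ∪ᵇ J) + rk R X
    key = begin
      size J + rk R X + rk R X                      ≡⟨ cong (λ s → s + rk R X + rk R X) J-indep ⟨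
      (rk R (J ∪ᵇ X) ∸ rk R X) + rk R X + rk R X    ≡⟨ cong₂ _+_ (m∸n+n≡m X≤J∪X) (sym (trans I-indep I-spans)) ⟩
      rk R (J ∪ᵇ X) + rk R I                        ≤⟨ +-mono-≤ (rk-mono R J∪X⊆) (rk-mono R I⊆) ⟩
      rk R ((I ∪ᵇ J) ∪ᵇ X) + rk R ((I ∪ᵇ J) ∩ᵇ X)   ≤⟨ rk-submodular R (I ∪ᵇ J) X ⟩
      rk R (I ∪ᵇ J) + rk R X                        ∎
      where
      J∪X⊆ : J ∪ᵇ X ⊆ᵇ (I ∪ᵇ J) ∪ᵇ X
      J∪X⊆ = ∪ᵇ-least (⊆ᵇ-trans (∪ᵇ-⊆ʳ I J) (∪ᵇ-⊆ˡ (I ∪ᵇ J) X)) (∪ᵇ-⊆ʳ (I ∪ᵇ J) X)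
      I⊆ : I ⊆ᵇ (I ∪ᵇ J) ∩ᵇ X
      I⊆ = ∩ᵇ-greatest {Y = I ∪ᵇ J} {X} (∪ᵇ-⊆ˡ I J) I⊆X

  ∉-independent-/⁅⁆ : ∀ R {e J} → rk R ⁅ e ⁆ᵇ ≡ 1 → Independent (R / ⁅ e ⁆ᵇ) J → J e ≡ false
  ∉-independent-/⁅⁆ R {e} {J} rk⁅e⁆≡1 J-indep with J e in e∈J
  ... | false = refl
  ... | true  = contradiction (≤-reflexive (sym rk/))
                  (<⇒≱ (≤-trans (s≤s (∸-monoˡ-≤ 1 (rk-≤-size R J))) (≤-reflexive size-1+)))
    where
    J∪e≗J : ∀ x → (J ∪ᵇ ⁅ e ⁆ᵇ) x ≡ J x
    J∪e≗J x with ⁅ e ⁆ᵇ x in x∈⁅e⁆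
    ... | false = ∨-identityʳ (J x)
    ... | true  = trans (∨-zeroʳ (J x)) (sym (⁅⁆ᵇ-⊆ {e = e} {X = J} e∈J x x∈⁅e⁆))
    rk/ : rk R J ∸ 1 ≡ size J
    rk/ = trans (cong₂ _∸_ (rk-cong R (λ x → sym (J∪e≗J x))) (sym rk⁅e⁆≡1)) J-indep
    size-1+ : suc (size J ∸ 1) ≡ size J
    size-1+ = trans (+-comm 1 _) (m∸n+n≡m
      (≤-trans (≤-reflexive (sym (weight-⁅⁆ _ e))) (weight-mono _ (⁅⁆ᵇ-⊆ {e = e} {X = J} e∈J))))

-- Edmonds' matroid union theorem, with multiplicities

module _ {n k : ℕ} where

  sumRank : (Fin k → RankFunction n) → Subsetᵇ n → ℕ
  sumRank Rs X = sum (λ i → rk (Rs i) X)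

  UnionCondition : (Fin k → RankFunction n) → Subsetᵇ n → (Fin n → ℕ) → Set
  UnionCondition Rs S w = ∀ X → X ⊆ᵇ S → weight w X ≤ sumRank Rs X

  multiplicity : (Fin k → Subsetᵇ n) → Fin n → ℕ
  multiplicity I e = sum (λ i → χ (I i e))

  record Cover (Rs : Fin k → RankFunction n) (S : Subsetᵇ n) (w : Fin n → ℕ) : Set where
    field
      part           : Fin k → Subsetᵇ n
      part-⊆         : ∀ i → part i ⊆ᵇ S
      part-indep     : ∀ i → Independent (Rs i) (part i)
      multiplicity-≡ : ∀ e → e ∈ᵇ S → multiplicity part e ≡ w e

  open Cover public

  cover-of-zero : ∀ Rs S w → (∀ e → e ∈ᵇ S → w e ≡ 0) → Cover Rs S w
  cover-of-zero Rs S w w≡0 = record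
    { part           = λ _ → ∅ᵇ
    ; part-⊆         = λ _ _ ()
    ; part-indep     = λ i → trans (rk-∅ (Rs i)) (sym (size-∅ {n}))
    ; multiplicity-≡ = λ e e∈S → trans (sum-replicate-zero k) (sym (w≡0 e e∈S))
    }

  ∑-size-part : ∀ {Rs S w} (C : Cover Rs S w) → sum (λ i → size (part C i)) ≡ weight w S
  ∑-size-part {Rs} {S} {w} C = trans (sym (∑-comm (λ e i → χ (part C i e)))) (sum-cong-≗ column)
    where
    column : ∀ e → multiplicity (part C) e ≡ (if S e then w e else 0)
    column e with S e in e∈S
    ... | true  = multiplicity-≡ C e e∈S
    ... | false = ∑-zero (λ i → cong χ (⊆ᵇ-∉ (part-⊆ C i) e∈S))

  part-spans : ∀ {Rs S w} (C : Cover Rs S w) → weight w S ≡ sumRank Rs S → ∀ i → size (part C i) ≡ rk (Rs i) S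
  part-spans {Rs} {S} C tight = ∑-mono-≤-equality size≤rk (≤-reflexive (trans (sym tight) (sym (∑-size-part C))))
    where
    size≤rk : ∀ i → size (part C i) ≤ rk (Rs i) S
    size≤rk i = ≤-trans (≤-reflexive (sym (part-indep C i))) (rk-mono (Rs i) (part-⊆ C i))

  cover⇒union-condition : ∀ {Rs S w} (I : Fin k → Subsetᵇ n) → (∀ i → Independent (Rs i) (I i)) →
                          (∀ e → e ∈ᵇ S → w e ≤ multiplicity I e) → UnionCondition Rs S w
  cover⇒union-condition {Rs} {S} {w} I I-indep w≤ X X⊆S = begin
    weight w X                                 ≤⟨ ∑-mono-≤ pointwise ⟩
    sum (λ e → sum (λ i → χ ((X ∩ᵇ I i) e)))   ≡⟨ ∑-comm (λ e i → χ ((X ∩ᵇ I i) e)) ⟩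
    sum (λ i → size (X ∩ᵇ I i))                ≤⟨ ∑-mono-≤ size≤rk ⟩
    sumRank Rs X                               ∎
    where
    open ≤-Reasoning
    pointwise : ∀ e → (if X e then w e else 0) ≤ sum (λ i → χ (X e ∧ I i e))
    pointwise e with X e in e∈X
    ... | true  = w≤ e (X⊆S e e∈X)
    ... | false = z≤n
    size≤rk : ∀ i → size (X ∩ᵇ I i) ≤ rk (Rs i) X
    size≤rk i = ≤-trans (≤-reflexive (sym (independent-⊆ (Rs i) (∩ᵇ-⊆ʳ X (I i)) (I-indep i))))
                        (rk-mono (Rs i) (∩ᵇ-⊆ˡ X (I i)))

  Tight : (Fin k → RankFunction n) → Subsetᵇ n → (Fin n → ℕ) → Subsetᵇ n → Set
  Tight Rs S w X = X ⊆ᵇ S × (∃ λ x → x ∈ᵇ X) × (∃ λ x → x ∈ᵇ S × X x ≡ false) × weight w X ≡ sumRank Rs X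

  tight? : ∀ Rs S w X → Dec (Tight Rs S w X)
  tight? Rs S w X = all? (λ x → (X x ≟ᵇ true) →-dec (S x ≟ᵇ true))
             ×-dec any? (λ x → X x ≟ᵇ true)
             ×-dec any? (λ x → (S x ≟ᵇ true) ×-dec (X x ≟ᵇ false))
             ×-dec (weight w X ≟ sumRank Rs X)

  tight-cong : ∀ Rs S w {X Y} → (∀ e → X e ≡ Y e) → Tight Rs S w X → Tight Rs S w Y
  tight-cong Rs S w {X} {Y} X≗Y (X⊆S , (x , x∈X) , (y , y∈S , y∉X) , X-tight) =
    (λ e e∈Y → X⊆S e (trans (X≗Y e) e∈Y)) , (x , trans (sym (X≗Y x)) x∈X) , (y , y∈S , trans (sym (X≗Y y)) y∉X) ,
    trans (sym (weight-cong w X≗Y)) (trans X-tight (sum-cong-≗ (λ i → rk-cong (Rs i) X≗Y)))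

  cover-split : ∀ {Rs S w X} → X ⊆ᵇ S → weight w X ≡ sumRank Rs X →
                Cover Rs X w → Cover (λ i → Rs i / X) (S ∖ᵇ X) w → Cover Rs S w
  cover-split {Rs} {S} {w} {X} X⊆S X-tight CX CY = record
    { part           = λ i → part CX i ∪ᵇ part CY i
    ; part-⊆         = λ i → ∪ᵇ-least (⊆ᵇ-trans (part-⊆ CX i) X⊆S) (⊆ᵇ-trans (part-⊆ CY i) (∖ᵇ-⊆ S X))
    ; part-indep     = λ i → independent-∪-/ (Rs i) (part-⊆ CX i) (part-indep CX i) (part-spans CX X-tight i)
                               (part-indep CY i) (λ e → ∖ᵇ-∉ {X = S} {Y = X} ∘ part-⊆ CY i e)
    ; multiplicity-≡ = multiplicity-∪
    }
    where
    multiplicity-∪ : ∀ e → e ∈ᵇ S → multiplicity (λ i → part CX i ∪ᵇ part CY i) e ≡ w e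
    multiplicity-∪ e e∈S with X e in e∈X
    ... | true  = trans (sum-cong-≗ only-CX) (multiplicity-≡ CX e e∈X)
      where
      only-CX : ∀ i → χ (part CX i e ∨ part CY i e) ≡ χ (part CX i e)
      only-CX i rewrite ⊆ᵇ-∉ (part-⊆ CY i) (∉-∖ᵇ {X = S} {Y = X} e∈X) = cong χ (∨-identityʳ _)
    ... | false = trans (sum-cong-≗ only-CY) (multiplicity-≡ CY e (cong₂ (λ a b → a ∧ not b) e∈S e∈X))
      where
      only-CY : ∀ i → χ (part CX i e ∨ part CY i e) ≡ χ (part CY i e)
      only-CY i rewrite ⊆ᵇ-∉ (part-⊆ CX i) e∈X = refl

  union-condition-/ : ∀ {Rs S w X} → X ⊆ᵇ S → weight w X ≡ sumRank Rs X →
                      UnionCondition Rs S w → UnionCondition (λ i → Rs i / X) (S ∖ᵇ X) w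
  union-condition-/ {Rs} {S} {w} {X} X⊆S X-tight cond Y Y⊆S∖X = +-cancelʳ-≤ (weight w X) _ _ (begin
    weight w Y + weight w X                      ≡⟨ weight-∪ w (λ e → ∖ᵇ-∉ {X = S} {Y = X} ∘ Y⊆S∖X e) ⟨
    weight w (Y ∪ᵇ X)                            ≤⟨ cond (Y ∪ᵇ X) (∪ᵇ-least (⊆ᵇ-trans Y⊆S∖X (∖ᵇ-⊆ S X)) X⊆S) ⟩
    sumRank Rs (Y ∪ᵇ X)                          ≡⟨ sum-cong-≗ (λ i → m∸n+n≡m (rk-mono (Rs i) (∪ᵇ-⊆ʳ Y X))) ⟨
    sum (λ i → rk (Rs i / X) Y + rk (Rs i) X)     ≡⟨ ∑-distrib-+ (λ i → rk (Rs i / X) Y) _ ⟩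
    sumRank (λ i → Rs i / X) Y + sumRank Rs X    ≡⟨ cong (sumRank (λ i → Rs i / X) Y +_) X-tight ⟨
    sumRank (λ i → Rs i / X) Y + weight w X      ∎)
    where open ≤-Reasoning

  cover-add : ∀ {Rs S w i e} → e ∈ᵇ S → 1 ≤ w e → rk (Rs i) ⁅ e ⁆ᵇ ≡ 1 →
              Cover (updateAt Rs i (_/ ⁅ e ⁆ᵇ)) S (λ x → w x ∸ χ (⁅ e ⁆ᵇ x)) → Cover Rs S w
  cover-add {Rs} {S} {w} {i} {e} e∈S 1≤we rk⁅e⁆≡1 C = record
    { part           = I
    ; part-⊆         = I-⊆
    ; part-indep     = I-indep
    ; multiplicity-≡ = multiplicity-I
    }
    where
    I : Fin k → Subsetᵇ n
    I = updateAt (part C) i (⁅ e ⁆ᵇ ∪ᵇ_)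
    Cᵢ-indep : Independent (Rs i / ⁅ e ⁆ᵇ) (part C i)
    Cᵢ-indep = subst (λ R → Independent R (part C i)) (updateAt-updates i Rs) (part-indep C i)
    e∉Cᵢ : part C i e ≡ false
    e∉Cᵢ = ∉-independent-/⁅⁆ (Rs i) rk⁅e⁆≡1 Cᵢ-indep
    I-⊆ : ∀ j → I j ⊆ᵇ S
    I-⊆ j with j ≟ᶠ i
    ... | yes refl rewrite updateAt-updates i {⁅ e ⁆ᵇ ∪ᵇ_} (part C) = ∪ᵇ-least (⁅⁆ᵇ-⊆ e∈S) (part-⊆ C i)
    ... | no  j≢i  rewrite updateAt-minimal j i {⁅ e ⁆ᵇ ∪ᵇ_} (part C) j≢i = part-⊆ C j
    I-indep : ∀ j → Independent (Rs j) (I j)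
    I-indep j with j ≟ᶠ i
    ... | yes refl rewrite updateAt-updates i {⁅ e ⁆ᵇ ∪ᵇ_} (part C) =
      independent-∪-/ (Rs i) ⊆ᵇ-refl (trans rk⁅e⁆≡1 (sym (weight-⁅⁆ _ e))) (trans (weight-⁅⁆ _ e) (sym rk⁅e⁆≡1))
        Cᵢ-indep (λ x x∈Cᵢ → ∉-⁅⁆ᵇ {e = e} {x} λ { refl → contradiction (trans (sym x∈Cᵢ) e∉Cᵢ) λ () })
    ... | no  j≢i  rewrite updateAt-minimal j i {⁅ e ⁆ᵇ ∪ᵇ_} (part C) j≢i =
      subst (λ R → Independent R (part C j)) (updateAt-minimal j i Rs j≢i) (part-indep C j)
    χ-I : ∀ x j → j ≢ i → χ (part C j x) ≡ χ (I j x)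
    χ-I x j j≢i = cong (λ Y → χ (Y x)) (sym (updateAt-minimal j i (part C) j≢i))
    χ-Iᵢ : ∀ x → χ (I i x) ≡ χ (⁅ e ⁆ᵇ x) + χ (part C i x)
    χ-Iᵢ x rewrite updateAt-updates i {⁅ e ⁆ᵇ ∪ᵇ_} (part C) with x ≟ᶠ e
    ... | yes refl rewrite e∉Cᵢ = refl
    ... | no  _    = refl
    multiplicity-I : ∀ x → x ∈ᵇ S → multiplicity I x ≡ w x
    multiplicity-I x x∈S = +-cancelʳ-≡ (χ (part C i x)) _ _ (begin
      multiplicity I x + χ (part C i x)                      ≡⟨ ∑-update (λ j → χ (part C j x)) (λ j → χ (I j x)) i (χ-I x) ⟩
      multiplicity (part C) x + χ (I i x)                    ≡⟨ cong₂ _+_ (multiplicity-≡ C x x∈S) (χ-Iᵢ x) ⟩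
      (w x ∸ χ (⁅ e ⁆ᵇ x)) + (χ (⁅ e ⁆ᵇ x) + χ (part C i x))  ≡⟨ +-assoc (w x ∸ χ (⁅ e ⁆ᵇ x)) _ _ ⟨
      (w x ∸ χ (⁅ e ⁆ᵇ x)) + χ (⁅ e ⁆ᵇ x) + χ (part C i x)    ≡⟨ cong (_+ χ (part C i x)) (m∸n+n≡m (χ⁅⁆≤ 1≤we x)) ⟩
      w x + χ (part C i x)                                   ∎)
      where open ≡-Reasoning

  union-condition-add : ∀ {Rs S w i e} → e ∈ᵇ S → 1 ≤ w e → rk (Rs i) ⁅ e ⁆ᵇ ≡ 1 →
                        (∀ X → ¬ Tight Rs S w X) → UnionCondition Rs S w →
                        UnionCondition (updateAt Rs i (_/ ⁅ e ⁆ᵇ)) S (λ x → w x ∸ χ (⁅ e ⁆ᵇ x))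
  union-condition-add {Rs} {S} {w} {i} {e} e∈S 1≤we rk⁅e⁆≡1 no-tight cond X X⊆S with any? (λ x → X x ≟ᵇ true)
  ... | no  X-empty = ≤-trans (≤-reflexive (weight-∅ _ λ x → ¬-not (X-empty ∘ (x ,_)))) z≤n
  ... | yes X-inhabited = +-cancelʳ-≤ 1 _ _ (≤-trans w′X+1≤Σ Σ≤Σ′+1)
    where
    Rs′ = updateAt Rs i (_/ ⁅ e ⁆ᵇ)
    w′ = λ x → w x ∸ χ (⁅ e ⁆ᵇ x)
    r = rk (Rs i)
    weight-w′ : weight w′ X + χ (X e) ≡ weight w X
    weight-w′ = trans (cong (weight w′ X +_) (sym (weight-χ⁅⁆ e X))) (weight-∸ X (χ⁅⁆≤ 1≤we))
    exchange : sumRank Rs′ X + r X ≡ sumRank Rs X + (r (X ∪ᵇ ⁅ e ⁆ᵇ) ∸ 1)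
    exchange = begin
      sumRank Rs′ X + r X                      ≡⟨ ∑-update (λ j → rk (Rs j) X) (λ j → rk (Rs′ j) X) i
                                                    (λ j j≢i → cong (λ R → rk R X) (sym (updateAt-minimal j i Rs j≢i))) ⟩
      sumRank Rs X + rk (Rs′ i) X              ≡⟨ cong (λ R → sumRank Rs X + rk R X) (updateAt-updates i Rs) ⟩
      sumRank Rs X + (r (X ∪ᵇ ⁅ e ⁆ᵇ) ∸ r ⁅ e ⁆ᵇ) ≡⟨ cong (λ m → sumRank Rs X + (r (X ∪ᵇ ⁅ e ⁆ᵇ) ∸ m)) rk⁅e⁆≡1 ⟩
      sumRank Rs X + (r (X ∪ᵇ ⁅ e ⁆ᵇ) ∸ 1)     ∎
      where open ≡-Reasoning
    Σ≤Σ′+1 : sumRank Rs X ≤ sumRank Rs′ X + 1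
    Σ≤Σ′+1 = +-cancelʳ-≤ (r X) _ _ (begin
      sumRank Rs X + r X                           ≤⟨ +-monoʳ-≤ (sumRank Rs X) (rk-mono (Rs i) (∪ᵇ-⊆ˡ X ⁅ e ⁆ᵇ)) ⟩
      sumRank Rs X + r (X ∪ᵇ ⁅ e ⁆ᵇ)               ≡⟨ cong (sumRank Rs X +_) (m∸n+n≡m 1≤r) ⟨
      sumRank Rs X + (r (X ∪ᵇ ⁅ e ⁆ᵇ) ∸ 1 + 1)     ≡⟨ +-assoc (sumRank Rs X) _ 1 ⟨
      sumRank Rs X + (r (X ∪ᵇ ⁅ e ⁆ᵇ) ∸ 1) + 1     ≡⟨ cong (_+ 1) exchange ⟨
      sumRank Rs′ X + r X + 1                      ≡⟨ +-assoc (sumRank Rs′ X) (r X) 1 ⟩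
      sumRank Rs′ X + (r X + 1)                    ≡⟨ cong (sumRank Rs′ X +_) (+-comm (r X) 1) ⟩
      sumRank Rs′ X + (1 + r X)                    ≡⟨ +-assoc (sumRank Rs′ X) 1 (r X) ⟨
      sumRank Rs′ X + 1 + r X                      ∎)
      where
      open ≤-Reasoning
      1≤r : 1 ≤ r (X ∪ᵇ ⁅ e ⁆ᵇ)
      1≤r = ≤-trans (≤-reflexive (sym rk⁅e⁆≡1)) (rk-mono (Rs i) (∪ᵇ-⊆ʳ X ⁅ e ⁆ᵇ))
    -- If e ∉ X, then X is not tight because e ∈ S ∖ X.
    w′X+1≤Σ : weight w′ X + 1 ≤ sumRank Rs X
    w′X+1≤Σ with X e in e∈X
    ... | true  = ≤-trans (≤-reflexive (trans (cong (λ b → weight w′ X + χ b) (sym e∈X)) weight-w′)) (cond X X⊆S)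
    ... | false = ≤-trans (≤-reflexive (trans (+-comm (weight w′ X) 1) (cong suc w′X≡wX)))
                          (≤∧≢⇒< (cond X X⊆S) λ tight → no-tight X (X⊆S , X-inhabited , (e , e∈S , e∈X) , tight))
      where
      w′X≡wX : weight w′ X ≡ weight w X
      w′X≡wX = trans (sym (+-identityʳ _)) (trans (cong (λ b → weight w′ X + χ b) (sym e∈X)) weight-w′)

  -- Induction on size S + weight w S: split along a tight set if there is one, otherwise place one element.
  union-theorem-≤ : ∀ F Rs S w → size S + weight w S ≤ F → UnionCondition Rs S w → Cover Rs S w
  union-theorem-≤ F Rs S w bound cond with any? (λ e → (S e ≟ᵇ true) ×-dec (1 ≤? w e))
  ... | no no-positive = cover-of-zero Rs S w (λ e e∈S → n<1⇒n≡0 (≰⇒> λ 1≤we → no-positive (e , e∈S , 1≤we)))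
  ... | yes (e , e∈S , 1≤we) with F | anySubset? (λ V → tight? Rs S w (lookup V))
  ...   | zero  | _ = contradiction bound (<⇒≱ (≤-trans 1≤we (≤-trans we≤ (m≤n+m _ (size S)))))
    where
    we≤ : w e ≤ weight w S
    we≤ = ≤-trans (≤-reflexive (sym (weight-⁅⁆ w e))) (weight-mono w (⁅⁆ᵇ-⊆ {e = e} {X = S} e∈S))
  ...   | suc F | yes (V , X⊆S , (x , x∈X) , (y , y∈S , y∉X) , X-tight) =
    cover-split X⊆S X-tight
      (union-theorem-≤ F Rs X w (smaller X⊆S y∈S y∉X) λ Y Y⊆X → cond Y (⊆ᵇ-trans Y⊆X X⊆S))
      (union-theorem-≤ F (λ i → Rs i / X) (S ∖ᵇ X) w
        (smaller (∖ᵇ-⊆ S X) (X⊆S x x∈X) (∉-∖ᵇ {X = S} {Y = X} x∈X))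
        (union-condition-/ {Rs} {S} {w} {X} X⊆S X-tight cond))
    where
    X = lookup V
    smaller : ∀ {Y} → Y ⊆ᵇ S → ∀ {z} → z ∈ᵇ S → Y z ≡ false → size Y + weight w Y ≤ F
    smaller Y⊆S z∈S z∉Y =
      ≤-pred (≤-trans (+-mono-<-≤ (weight-mono-< _ Y⊆S z∈S z∉Y (s≤s z≤n)) (weight-mono w Y⊆S)) bound)
  ...   | suc F | no no-tight =
    cover-add e∈S 1≤we rk⁅e⁆≡1
      (union-theorem-≤ F (updateAt Rs i (_/ ⁅ e ⁆ᵇ)) S w′ smaller
        (union-condition-add e∈S 1≤we rk⁅e⁆≡1 no-tightᵇ cond))
    where
    w′ = λ x → w x ∸ χ (⁅ e ⁆ᵇ x)
    no-tightᵇ : ∀ X → ¬ Tight Rs S w X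
    no-tightᵇ X tight = no-tight (tabulate X , tight-cong Rs S w (λ x → sym (lookup∘tabulate X x)) tight)
    rk⁅e⁆-positive : ∃ λ i → 1 ≤ rk (Rs i) ⁅ e ⁆ᵇ
    rk⁅e⁆-positive = ∑-positive _
      (≤-trans 1≤we (≤-trans (≤-reflexive (sym (weight-⁅⁆ w e))) (cond ⁅ e ⁆ᵇ (⁅⁆ᵇ-⊆ {e = e} {X = S} e∈S))))
    i = proj₁ rk⁅e⁆-positive
    rk⁅e⁆≡1 : rk (Rs i) ⁅ e ⁆ᵇ ≡ 1
    rk⁅e⁆≡1 = ≤-antisym (≤-trans (rk-≤-size (Rs i) ⁅ e ⁆ᵇ) (≤-reflexive (weight-⁅⁆ _ e))) (proj₂ rk⁅e⁆-positive)
    smaller : size S + weight w′ S ≤ F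
    smaller = +-cancelʳ-≤ 1 _ _ (≤-trans (≤-reflexive (begin
      size S + weight w′ S + 1            ≡⟨ +-assoc (size S) _ 1 ⟩
      size S + (weight w′ S + χ true)     ≡⟨ cong (λ b → size S + (weight w′ S + χ b)) e∈S ⟨
      size S + (weight w′ S + χ (S e))    ≡⟨ cong (size S +_) weight-w′ ⟩
      size S + weight w S                 ∎)) (≤-trans bound (≤-reflexive (+-comm 1 F))))
      where
      open ≡-Reasoning
      weight-w′ : weight w′ S + χ (S e) ≡ weight w S
      weight-w′ = trans (cong (weight w′ S +_) (sym (weight-χ⁅⁆ e S))) (weight-∸ S (χ⁅⁆≤ 1≤we))

  union-theorem : ∀ Rs S w → UnionCondition Rs S w → Cover Rs S w
  union-theorem Rs S w = union-theorem-≤ (size S + weight w S) Rs S w ≤-refl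

-- The rank function of a matroid

module MatroidRank {n : ℕ} (M : Matroid n) where

  Indep : Subsetᵇ n → Set
  Indep X = T (indep M (tabulate X))

  indep-⊆ᵛ : ∀ {V X} → (∀ x → x ∈ᵇ X → x ∈ V) → T (indep M V) → Indep X
  indep-⊆ᵛ {V} X⊆V = indep-sub M V _ (λ x∈X → X⊆V _ (∈-tabulate⁻ x∈X))

  indep-⊆ : ∀ {X Y} → X ⊆ᵇ Y → Indep Y → Indep X
  indep-⊆ X⊆Y = indep-⊆ᵛ (λ x x∈X → ∈-tabulate⁺ (X⊆Y x x∈X))

  indep-∅ : Indep ∅ᵇ
  indep-∅ = indep-⊆ᵛ (λ _ ()) (indep-empty M)

  indep-augment : ∀ {X Y} → Indep X → Indep Y → size X < size Y →
                  ∃ λ e → e ∈ᵇ Y × X e ≡ false × Indep (X ∪ᵇ ⁅ e ⁆ᵇ)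
  indep-augment {X} {Y} X-indep Y-indep X<Y
    with indep-aug M (tabulate X) (tabulate Y) X-indep Y-indep (subst₂ _<_ (sym (∣tabulate∣ X)) (sym (∣tabulate∣ Y)) X<Y)
  ... | e , e∈Y , e∉X , X∪e-indep = e , ∈-tabulate⁻ e∈Y , ¬-not (e∉X ∘ ∈-tabulate⁺) , indep-⊆ᵛ ⊆X∪e X∪e-indep
    where
    ⊆X∪e : ∀ x → x ∈ᵇ X ∪ᵇ ⁅ e ⁆ᵇ → x ∈ tabulate X ∪ ⁅ e ⁆
    ⊆X∪e x x∈X∪e with X x in x∈X
    ... | true  = p⊆p∪q ⁅ e ⁆ (∈-tabulate⁺ x∈X)
    ... | false rewrite ∈-⁅⁆ᵇ⇒≡ {e = e} {x = x} x∈X∪e = q⊆p∪q (tabulate X) ⁅ e ⁆ (x∈⁅x⁆ e)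

  greedy : Subsetᵇ n → List (Fin n) → Subsetᵇ n → Subsetᵇ n
  greedy X []       J = J
  greedy X (e ∷ es) J = greedy X es (if X e ∧ indep M (tabulate (J ∪ᵇ ⁅ e ⁆ᵇ)) then J ∪ᵇ ⁅ e ⁆ᵇ else J)

  greedy-⊇ : ∀ X es J → J ⊆ᵇ greedy X es J
  greedy-⊇ X []       J = ⊆ᵇ-refl
  greedy-⊇ X (e ∷ es) J with X e ∧ indep M (tabulate (J ∪ᵇ ⁅ e ⁆ᵇ))
  ... | true  = ⊆ᵇ-trans (∪ᵇ-⊆ˡ J ⁅ e ⁆ᵇ) (greedy-⊇ X es (J ∪ᵇ ⁅ e ⁆ᵇ))
  ... | false = greedy-⊇ X es J

  greedy-⊆ : ∀ X es J → greedy X es J ⊆ᵇ J ∪ᵇ X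
  greedy-⊆ X []       J = ∪ᵇ-⊆ˡ J X
  greedy-⊆ X (e ∷ es) J with X e ∧ indep M (tabulate (J ∪ᵇ ⁅ e ⁆ᵇ)) in added
  ... | true  = ⊆ᵇ-trans (greedy-⊆ X es (J ∪ᵇ ⁅ e ⁆ᵇ)) (∪ᵇ-least (∪ᵇ-least (∪ᵇ-⊆ˡ J X) ⁅e⁆⊆J∪X) (∪ᵇ-⊆ʳ J X))
    where
    ⁅e⁆⊆J∪X = ⊆ᵇ-trans (⁅⁆ᵇ-⊆ {e = e} {X = X} (∧-conicalˡ _ _ added)) (∪ᵇ-⊆ʳ J X)
  ... | false = greedy-⊆ X es J

  greedy-indep : ∀ X es J → Indep J → Indep (greedy X es J)
  greedy-indep X []       J J-indep = J-indep
  greedy-indep X (e ∷ es) J J-indep with X e ∧ indep M (tabulate (J ∪ᵇ ⁅ e ⁆ᵇ)) in added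
  ... | true  = greedy-indep X es (J ∪ᵇ ⁅ e ⁆ᵇ) (T-≡ .Equivalence.from (∧-conicalʳ (X e) _ added))
  ... | false = greedy-indep X es J J-indep

  Maximal : Subsetᵇ n → Subsetᵇ n → Set
  Maximal X K = ∀ e → e ∈ᵇ X → e ∈ᵇ K ⊎ ¬ Indep (K ∪ᵇ ⁅ e ⁆ᵇ)

  greedy-maximal : ∀ X es J e → e ∈ˡ es → e ∈ᵇ X → e ∈ᵇ greedy X es J ⊎ ¬ Indep (greedy X es J ∪ᵇ ⁅ e ⁆ᵇ)
  greedy-maximal X (e′ ∷ es) J e (there e∈es) e∈X = greedy-maximal X es _ e e∈es e∈X
  greedy-maximal X (e  ∷ es) J e (here refl)  e∈X with indep M (tabulate (J ∪ᵇ ⁅ e ⁆ᵇ)) in J∪e-indep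
  ... | true  rewrite e∈X = inj₁ (greedy-⊇ X es (J ∪ᵇ ⁅ e ⁆ᵇ) e (∪ᵇ-⊆ʳ J ⁅ e ⁆ᵇ e (∈-⁅⁆ᵇ e)))
  ... | false rewrite e∈X = inj₂ λ K∪e-indep →
    subst T J∪e-indep (indep-⊆ (∪ᵇ-least (⊆ᵇ-trans (greedy-⊇ X es J) (∪ᵇ-⊆ˡ _ ⁅ e ⁆ᵇ)) (∪ᵇ-⊆ʳ _ ⁅ e ⁆ᵇ)) K∪e-indep)

  size-≤-maximal : ∀ {X K Y} → Indep K → Maximal X K → Indep Y → Y ⊆ᵇ X → size Y ≤ size K
  size-≤-maximal {X} {K} {Y} K-indep K-maximal Y-indep Y⊆X with size Y ≤? size K
  ... | yes Y≤K = Y≤K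
  ... | no  Y≰K with indep-augment K-indep Y-indep (≰⇒> Y≰K)
  ...   | e , e∈Y , e∉K , K∪e-indep with K-maximal e (Y⊆X e e∈Y)
  ...     | inj₁ e∈K      = contradiction (trans (sym e∈K) e∉K) λ ()
  ...     | inj₂ K∪e-dep  = contradiction K∪e-indep K∪e-dep

  basis : Subsetᵇ n → Subsetᵇ n
  basis X = greedy X (allFin n) ∅ᵇ

  basis-indep : ∀ X → Indep (basis X)
  basis-indep X = greedy-indep X (allFin n) ∅ᵇ indep-∅

  basis-⊆ : ∀ X → basis X ⊆ᵇ X
  basis-⊆ X = greedy-⊆ X (allFin n) ∅ᵇ

  rank : Subsetᵇ n → ℕ
  rank X = size (basis X)

  size-≤-rank : ∀ {X Y} → Indep Y → Y ⊆ᵇ X → size Y ≤ rank X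
  size-≤-rank {X} = size-≤-maximal (basis-indep X) (λ e → greedy-maximal X (allFin n) ∅ᵇ e (∈-allFin e))

  rank-submodular : ∀ A B → rank (A ∪ᵇ B) + rank (A ∩ᵇ B) ≤ rank A + rank B
  rank-submodular A B = begin
    rank (A ∪ᵇ B) + size I                  ≤⟨ +-monoˡ-≤ (size I) (size-≤-maximal K-indep K-maximal (basis-indep _) (basis-⊆ _)) ⟩
    size K + size I                         ≤⟨ counting ⟩
    size (K ∩ᵇ A) + size (K ∩ᵇ B)           ≤⟨ +-mono-≤ (size-≤-rank (indep-⊆ (∩ᵇ-⊆ˡ K A) K-indep) (∩ᵇ-⊆ʳ K A))
                                                        (size-≤-rank (indep-⊆ (∩ᵇ-⊆ˡ K B) K-indep) (∩ᵇ-⊆ʳ K B)) ⟩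
    rank A + rank B                         ∎
    where
    open ≤-Reasoning
    -- Extend a basis I of A ∩ B to a maximal independent subset K of A ∪ B.
    I = basis (A ∩ᵇ B)
    K = greedy (A ∪ᵇ B) (allFin n) I
    K-indep : Indep K
    K-indep = greedy-indep (A ∪ᵇ B) (allFin n) I (basis-indep _)
    K-maximal : Maximal (A ∪ᵇ B) K
    K-maximal e = greedy-maximal (A ∪ᵇ B) (allFin n) I e (∈-allFin e)
    I⊆A∩B : I ⊆ᵇ A ∩ᵇ B
    I⊆A∩B = basis-⊆ (A ∩ᵇ B)
    K⊆A∪B : K ⊆ᵇ A ∪ᵇ B
    K⊆A∪B = ⊆ᵇ-trans (greedy-⊆ (A ∪ᵇ B) (allFin n) I)
                     (∪ᵇ-least (⊆ᵇ-trans I⊆A∩B (⊆ᵇ-trans (∩ᵇ-⊆ˡ A B) (∪ᵇ-⊆ˡ A B))) ⊆ᵇ-refl)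
    pointwise : ∀ x → χ (K x) + χ (I x) ≤ χ (K x ∧ A x) + χ (K x ∧ B x)
    pointwise x with I x in x∈I
    ... | true  rewrite greedy-⊇ (A ∪ᵇ B) (allFin n) I x x∈I
                      | ∧-conicalˡ (A x) (B x) (I⊆A∩B x x∈I) | ∧-conicalʳ (A x) (B x) (I⊆A∩B x x∈I) = ≤-refl
    ... | false with K x in x∈K
    ...   | false = z≤n
    ...   | true  with A x | K⊆A∪B x x∈K
    ...     | true  | _    = s≤s z≤n
    ...     | false | x∈B rewrite x∈B = s≤s z≤n
    counting : size K + size I ≤ size (K ∩ᵇ A) + size (K ∩ᵇ B)
    counting = subst₂ _≤_ (∑-distrib-+ (χ ∘ K) (χ ∘ I)) (∑-distrib-+ (χ ∘ (K ∩ᵇ A)) (χ ∘ (K ∩ᵇ B)))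
                         (∑-mono-≤ pointwise)

  rank-function : RankFunction n
  rank-function = record
    { rk            = rank
    ; rk-≤-size     = λ X → weight-mono _ (basis-⊆ X)
    ; rk-mono       = λ {X} X⊆Y → size-≤-rank (basis-indep X) (⊆ᵇ-trans (basis-⊆ X) X⊆Y)
    ; rk-submodular = rank-submodular
    }

  independent⇒indep : ∀ {X} → Independent rank-function X → Indep X
  independent⇒indep {X} rank≡size = indep-⊆ (size-⊆-≥⇒⊇ (basis-⊆ X) (≤-reflexive (sym rank≡size))) (basis-indep X)

  indep⇒independent : ∀ {X} → Indep X → Independent rank-function X
  indep⇒independent X-indep = ≤-antisym (weight-mono _ (basis-⊆ _)) (size-≤-rank X-indep ⊆ᵇ-refl)

occurs : ℕ → List ℕ → Bool
occurs j xs = does (any?ˡ (j ≟_) xs)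

occurs⁺ : ∀ {j xs} → j ∈ˡ xs → occurs j xs ≡ true
occurs⁺ {j} {xs} = dec-true (any?ˡ (j ≟_) xs)

occurs⁻ : ∀ {j xs} → occurs j xs ≡ true → j ∈ˡ xs
occurs⁻ {j} {xs} occ with any?ˡ (j ≟_) xs
... | yes j∈xs = j∈xs

length-≤-∑-occurs : ∀ {m} (xs : List ℕ) → Unique xs → (∀ x → x ∈ˡ xs → 1 ≤ x × x ≤ m) →
                    length xs ≤ sum (λ (j : Fin m) → χ (occurs (suc (toℕ j)) xs))
length-≤-∑-occurs []       _                  _       = z≤n
length-≤-∑-occurs {m} (x ∷ xs) (x≢xs ∷ xs-unique) bounded =
  ≤-trans (s≤s (length-≤-∑-occurs xs xs-unique (λ y → bounded y ∘ there))) (∑-mono-< occurs-more j₀ occurs-new)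
  where
  occurs-more : ∀ j → χ (occurs (suc (toℕ j)) xs) ≤ χ (occurs (suc (toℕ j)) (x ∷ xs))
  occurs-more j with occurs (suc (toℕ j)) xs
  ... | false = z≤n
  ... | true  rewrite ∨-zeroʳ (does (suc (toℕ j) ≟ x)) = ≤-refl
  1≤x = proj₁ (bounded x (here refl))
  j₀ : Fin m
  j₀ = fromℕ< (≤-trans (≤-reflexive (trans (+-comm 1 (x ∸ 1)) (m∸n+n≡m 1≤x))) (proj₂ (bounded x (here refl))))
  suc-j₀≡x : suc (toℕ j₀) ≡ x
  suc-j₀≡x = trans (cong suc (toℕ-fromℕ< _)) (trans (+-comm 1 (x ∸ 1)) (m∸n+n≡m 1≤x))
  occurs-new : χ (occurs (suc (toℕ j₀)) xs) < χ (occurs (suc (toℕ j₀)) (x ∷ xs))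
  occurs-new = subst (λ y → χ (occurs y xs) < χ (occurs y (x ∷ xs))) (sym suc-j₀≡x)
                 (subst₂ (λ a b → χ a < χ b) (sym (dec-false (any?ˡ (x ≟_) xs) (All¬⇒¬Any x≢xs)))
                         (sym (occurs⁺ {xs = x ∷ xs} (here refl))) (s≤s z≤n))

-- The on-line game

module Game {n : ℕ} (M : Matroid n) (m : ℕ) where

  open MatroidRank M

  atLeast : ℕ → (Fin n → ℕ) → Subsetᵇ n
  atLeast j L e = j ≤ᵇ L e

  ∈-atLeast⁺ : ∀ {j L e} → j ≤ L e → e ∈ᵇ atLeast j L
  ∈-atLeast⁺ j≤Le = T-≡ .Equivalence.to (≤⇒≤ᵇ j≤Le)

  ∈-atLeast⁻ : ∀ {j L e} → e ∈ᵇ atLeast j L → j ≤ L e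
  ∈-atLeast⁻ {j} {L} {e} e∈ = ≤ᵇ⇒≤ j (L e) (T-≡ .Equivalence.from e∈)

  -- L e is the number of colours still to be offered to e; levels L j is M restricted to {e | L e > j}.
  levels : (Fin n → ℕ) → Fin m → RankFunction n
  levels L j = rank-function ↾ atLeast (suc (toℕ j)) L

  -- Edmonds' condition for W-colourability from the lists {1, …, L e}, provided L ≤ m.
  Feasible : (Fin n → ℕ) → (Fin n → ℕ) → Set
  Feasible W L = UnionCondition (levels L) (λ _ → true) W

  level-step : ∀ X B L j → let L′ = λ e → L e ∸ χ (B e) in
    rank (X ∩ᵇ atLeast j L) + rank (X ∩ᵇ B ∩ᵇ atLeast (suc j) L)
      ≤ rank (X ∩ᵇ atLeast j L′) + rank (X ∩ᵇ B ∩ᵇ atLeast j L)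
  level-step X B L j = ≤-trans (+-mono-≤ (rk-mono rank-function ⊆P∪Q) (rk-mono rank-function ⊆P∩Q)) (rank-submodular P Q)
    where
    L′ = λ e → L e ∸ χ (B e)
    Eʲ = atLeast j L
    Eʲ⁺¹ = atLeast (suc j) L
    P = X ∩ᵇ atLeast j L′
    Q = X ∩ᵇ B ∩ᵇ Eʲ
    ⊆P∪Q : X ∩ᵇ Eʲ ⊆ᵇ P ∪ᵇ Q
    ⊆P∪Q e e∈ = by-B (B e) refl
      where
      e∈X = ∩ᵇ-⊆ˡ X Eʲ e e∈
      j≤Le = ∈-atLeast⁻ {L = L} (∩ᵇ-⊆ʳ X Eʲ e e∈)
      by-B : ∀ b → B e ≡ b → (P ∪ᵇ Q) e ≡ true
      by-B true  e∈B = ∪ᵇ-⊆ʳ P Q e (∈-∩ᵇ X (B ∩ᵇ Eʲ) e∈X (∈-∩ᵇ B Eʲ e∈B (∈-atLeast⁺ {L = L} j≤Le)))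
      by-B false e∉B = ∪ᵇ-⊆ˡ P Q e (∈-∩ᵇ X (atLeast j L′) e∈X (∈-atLeast⁺ {L = L′} (subst (j ≤_) L≡L′ j≤Le)))
        where
        L≡L′ : L e ≡ L′ e
        L≡L′ = cong (λ b → L e ∸ χ b) (sym e∉B)
    ⊆P∩Q : X ∩ᵇ B ∩ᵇ Eʲ⁺¹ ⊆ᵇ P ∩ᵇ Q
    ⊆P∩Q e e∈ = ∈-∩ᵇ P Q (∈-∩ᵇ X (atLeast j L′) e∈X (∈-atLeast⁺ {L = L′} j≤L′e))
                           (∈-∩ᵇ X (B ∩ᵇ Eʲ) e∈X (∈-∩ᵇ B Eʲ e∈B (∈-atLeast⁺ {L = L} (≤-trans (n≤1+n j) 1+j≤Le))))
      where
      e∈B∩E = ∩ᵇ-⊆ʳ X (B ∩ᵇ Eʲ⁺¹) e e∈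
      e∈X = ∩ᵇ-⊆ˡ X (B ∩ᵇ Eʲ⁺¹) e e∈
      e∈B = ∩ᵇ-⊆ˡ B Eʲ⁺¹ e e∈B∩E
      1+j≤Le = ∈-atLeast⁻ {L = L} (∩ᵇ-⊆ʳ B Eʲ⁺¹ e e∈B∩E)
      j≤L′e : j ≤ L′ e
      j≤L′e = subst (j ≤_) (cong (λ b → L e ∸ χ b) (sym e∈B)) (∸-monoˡ-≤ 1 1+j≤Le)

  levels-step : ∀ X B L → sumRank (levels L) X ≤ rank (X ∩ᵇ B) + sumRank (levels (λ e → L e ∸ χ (B e))) X
  levels-step X B L = begin
    sumRank (levels L) X                               ≤⟨ m≤m+n _ _ ⟩
    sumRank (levels L) X + h m                         ≤⟨ telescoping {h = h} (λ s → level-step X B L (suc s)) m ⟩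
    sumRank (levels L′) X + h 0                        ≤⟨ +-monoʳ-≤ _ (rk-mono rank-function ⊆X∩B) ⟩
    sumRank (levels L′) X + rank (X ∩ᵇ B)              ≡⟨ +-comm _ (rank (X ∩ᵇ B)) ⟩
    rank (X ∩ᵇ B) + sumRank (levels L′) X              ∎
    where
    open ≤-Reasoning
    L′ = λ e → L e ∸ χ (B e)
    h = λ s → rank (X ∩ᵇ B ∩ᵇ atLeast (suc s) L)
    E¹ = atLeast 1 L
    ⊆X∩B : X ∩ᵇ B ∩ᵇ E¹ ⊆ᵇ X ∩ᵇ B
    ⊆X∩B = ∩ᵇ-greatest {Y = X} {B} (∩ᵇ-⊆ˡ X (B ∩ᵇ E¹)) λ e → ∩ᵇ-⊆ˡ B E¹ e ∘ ∩ᵇ-⊆ʳ X (B ∩ᵇ E¹) e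

  record Answer (W L : Fin n → ℕ) (B : Subsetᵇ n) : Set where
    field
      answer          : Subsetᵇ n
      answer-⊆        : answer ⊆ᵇ B
      answer-indep    : Indep answer
      answer-needed   : ∀ e → e ∈ᵇ answer → 1 ≤ W e
      answer-feasible : Feasible (λ e → W e ∸ χ (answer e)) (λ e → L e ∸ χ (B e))

  -- Alice answers with the part of a cover that belongs to M ↾ B; the other parts witness feasibility afterwards.
  alice-move : ∀ {W L} (B : Subsetᵇ n) → Feasible W L → Answer W L B
  alice-move {W} {L} B feasible = record
    { answer          = A
    ; answer-⊆        = proj₁ A-indep↾
    ; answer-indep    = independent⇒indep (proj₂ A-indep↾)
    ; answer-needed   = A-needed
    ; answer-feasible = feasible′
    }
    where
    L′ = λ e → L e ∸ χ (B e)
    cover : Cover ((rank-function ↾ B) ◂ levels L′) (λ _ → true) W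
    cover = union-theorem _ _ W λ X X⊆E → ≤-trans (feasible X X⊆E) (levels-step X B L)
    A = part cover zero
    A-indep↾ = independent-↾ rank-function B A (part-indep cover zero)
    rest : ∀ e → χ (A e) + multiplicity (part cover ∘ suc) e ≡ W e
    rest e = multiplicity-≡ cover e refl
    A-needed : ∀ e → e ∈ᵇ A → 1 ≤ W e
    A-needed e e∈A = ≤-trans (≤-reflexive (cong χ (sym e∈A))) (≤-trans (m≤m+n _ _) (≤-reflexive (rest e)))
    feasible′ : Feasible (λ e → W e ∸ χ (A e)) L′
    feasible′ = cover⇒union-condition {Rs = levels L′} (part cover ∘ suc) (part-indep cover ∘ suc)
      λ e _ → ≤-reflexive (trans (cong (_∸ χ (A e)) (sym (rest e))) (m+n∸m≡n (χ (A e)) _))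

  feasible-exhausted : ∀ {W L} → Feasible W L → (∀ e → L e ≡ 0) → ∀ e → W e ≡ 0
  feasible-exhausted {W} {L} feasible L≡0 e = n≤0⇒n≡0 (begin
    W e                                ≡⟨ weight-⁅⁆ W e ⟨
    weight W ⁅ e ⁆ᵇ                    ≤⟨ feasible ⁅ e ⁆ᵇ (λ _ _ → refl) ⟩
    sumRank (levels L) ⁅ e ⁆ᵇ          ≡⟨ ∑-zero (λ j → trans (rk-cong rank-function (empty j)) (rk-∅ rank-function)) ⟩
    0                                  ∎)
    where
    open ≤-Reasoning
    empty : ∀ (j : Fin m) x → (⁅ e ⁆ᵇ ∩ᵇ atLeast (suc (toℕ j)) L) x ≡ false
    empty j x rewrite L≡0 x = ∧-zeroʳ (⁅ e ⁆ᵇ x)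

  feasible-cong : ∀ {W W′ L L′} → (∀ e → W e ≡ W′ e) → (∀ e → L e ≡ L′ e) → Feasible W L → Feasible W′ L′
  feasible-cong {W} {W′} {L} {L′} W≗W′ L≗L′ feasible X X⊆E = begin
    weight W′ X             ≡⟨ sum-cong-≗ (λ e → cong (λ v → if X e then v else 0) (W≗W′ e)) ⟨
    weight W X              ≤⟨ feasible X X⊆E ⟩
    sumRank (levels L) X    ≡⟨ sum-cong-≗ level≗ ⟩
    sumRank (levels L′) X   ∎
    where
    open ≤-Reasoning
    level≗ : ∀ (j : Fin m) → rk (levels L j) X ≡ rk (levels L′ j) X
    level≗ j = rk-cong rank-function (λ e → cong (λ v → X e ∧ (suc (toℕ j) ≤ᵇ v)) (L≗L′ e))

  ∸-bump : ∀ (t x : Fin n → ℕ) V e → t e ∸ bump M x V e ≡ t e ∸ x e ∸ χ (lookup V e)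
  ∸-bump t x V e with lookup V e
  ... | true  = sym (trans (∸-+-assoc (t e) (x e) 1) (cong (t e ∸_) (+-comm (x e) 1)))
  ... | false = refl

  bump-≤ : ∀ {a w : Fin n → ℕ} V → (∀ e → a e ≤ w e) → (∀ e → e ∈ V → a e < w e) → ∀ e → bump M a V e ≤ w e
  bump-≤ V a≤w V-allowed e with lookup V e in e∈V
  ... | true  = V-allowed e (lookup⇒[]= e V e∈V)
  ... | false = a≤w e

  ∑-∸-bump-< : ∀ {s ℓ : Fin n → ℕ} B → Nonempty B → (∀ e → e ∈ B → s e < ℓ e) →
               sum (λ e → ℓ e ∸ bump M s B e) < sum (λ e → ℓ e ∸ s e)
  ∑-∸-bump-< {s} {ℓ} B (f , f∈B) B-open = ∑-mono-< no-more f fewer-at-f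
    where
    no-more : ∀ e → ℓ e ∸ bump M s B e ≤ ℓ e ∸ s e
    no-more e = ≤-trans (≤-reflexive (∸-bump ℓ s B e)) (m∸n≤m (ℓ e ∸ s e) (χ (lookup B e)))
    fewer-at-f : ℓ f ∸ bump M s B f < ℓ f ∸ s f
    fewer-at-f rewrite []=⇒lookup f∈B = ∸-monoʳ-< (n<1+n (s f)) (B-open f f∈B)

  -- Induction on the number of colours Bob still has to offer.
  alice-wins : ∀ {w ℓ} F s a → sum (λ e → ℓ e ∸ s e) ≤ F → (∀ e → a e ≤ w e) →
               Feasible (λ e → w e ∸ a e) (λ e → ℓ e ∸ s e) → AliceWins M w ℓ s a
  alice-wins {w} {ℓ} F s a bound a≤w feasible = win finished respond
    where
    finished : (∀ e → s e ≡ ℓ e) → ∀ e → a e ≡ w e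
    finished s≡ℓ e = ≤-antisym (a≤w e)
      (m∸n≡0⇒m≤n (feasible-exhausted feasible (λ x → trans (cong (ℓ x ∸_) (s≡ℓ x)) (n∸n≡0 (ℓ x))) e))
    respond : ∀ B → Nonempty B → (∀ e → e ∈ B → s e < ℓ e) →
              Σ (Subset n) λ A → A ⊆ B × T (indep M A) × (∀ e → e ∈ A → a e < w e) ×
                AliceWins M w ℓ (bump M s B) (bump M a A)
    respond B B-nonempty B-open =
      tabulate answer , (λ {x} x∈A → lookup⇒[]= x B (answer-⊆ x (∈-tabulate⁻ x∈A))) , answer-indep , allowed , next F bound
      where
      open Answer (alice-move {λ e → w e ∸ a e} {λ e → ℓ e ∸ s e} (lookup B) feasible)
      allowed : ∀ e → e ∈ tabulate answer → a e < w e
      allowed e e∈A = m∸n≢0⇒n<m λ w∸a≡0 → contradiction (subst (1 ≤_) w∸a≡0 (answer-needed e (∈-tabulate⁻ e∈A))) λ ()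
      fewer = ∑-∸-bump-< B B-nonempty B-open
      next : ∀ F → sum (λ e → ℓ e ∸ s e) ≤ F → AliceWins M w ℓ (bump M s B) (bump M a (tabulate answer))
      next zero    bound = contradiction bound (<⇒≱ (≤-trans (s≤s z≤n) fewer))
      next (suc F) bound = alice-wins F (bump M s B) (bump M a (tabulate answer)) (≤-pred (≤-trans fewer bound))
        (bump-≤ (tabulate answer) a≤w allowed)
        (feasible-cong W≗ (λ e → sym (∸-bump ℓ s B e)) answer-feasible)
        where
        W≗ : ∀ e → w e ∸ a e ∸ χ (answer e) ≡ w e ∸ bump M a (tabulate answer) e
        W≗ e = trans (cong (λ b → w e ∸ a e ∸ χ b) (sym (lookup∘tabulate answer e))) (sym (∸-bump w a (tabulate answer) e))

  colouring⇒feasible : ∀ {w ℓ} → WColorableFromInitialLists M w ℓ → (∀ e → ℓ e ≤ m) → Feasible w ℓ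
  colouring⇒feasible {w} {ℓ} (W , (W-unique , W-length , classes-indep) , W-lists) ℓ≤m =
    cover⇒union-condition {Rs = levels ℓ} class class-indep λ e _ →
      subst (_≤ multiplicity class e) (W-length e)
        (length-≤-∑-occurs (W e) (W-unique e) λ x x∈We →
          proj₁ (W-lists e x x∈We) , ≤-trans (proj₂ (W-lists e x x∈We)) (ℓ≤m e))
    where
    class : Fin m → Subsetᵇ n
    class j e = occurs (suc (toℕ j)) (W e)
    class-indep : ∀ j → Independent (levels ℓ j) (class j)
    class-indep j = independent-↾⁺ rank-function
      (λ e e∈ → ∈-atLeast⁺ {L = ℓ} (proj₂ (W-lists e (suc (toℕ j)) (occurs⁻ e∈))))
      (indep⇒independent (classes-indep (suc (toℕ j))))

theorem6 : (n : ℕ) (M : Matroid n) (w ℓ : Fin n → ℕ) →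
    (∀ e → 1 ≤ w e) → (∀ e → 1 ≤ ℓ e) →
    WColorableFromInitialLists M w ℓ → OnlineColorable M w ℓ
theorem6 n M w ℓ _ _ colourable =
  alice-wins (sum ℓ) (λ _ → 0) (λ _ → 0) ≤-refl (λ _ → z≤n) (colouring⇒feasible colourable (∑-≥-term ℓ))
  where open Game M (sum ℓ)
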